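{- For every integer $n\geq 1$, the number of Fishburn permutations of length $n$ that simultaneously avoid the classical patterns $321$, $3124$ and $4123$ equals $F_{n+1}-1$, where $F_n$ is the Fibonacci number defined by $F_0=F_1=1$ and $F_n=F_{n-1}+F_{n-2}$ for $n\geq 2$.
   Context: A permutation of length $n$ is a rearrangement $\pi=\pi_1\cdots\pi_n$ of $[n]$. A permutation $\pi$ contains a classical pattern $p\in S_k$ if some subsequence of $\pi$ of length $k$ is order-isomorphic to $p$; otherwise it avoids $p$. A Fishburn permutation is a permutation $\pi$ for which there are no indices $i<j$ with $\pi_j<\pi_i<\pi_{i+1}$ and $\pi_i=\pi_j+1$. -}

module Defs where

open import Data.Nat using (ℕ; zero; suc; _+_; _∸_; _<ᵇ_; _≡ᵇ_)
open import Data.Bool using (Bool; true; false; _∧_; _∨_; not; if_then_else_)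
open import Data.List using (List; []; _∷_; map; concatMap; length; filter; applyUpTo)
open import Data.Bool.ListAction using (any; all)
open import Data.Bool using (T)
open import Relation.Nullary.Decidable using (Dec)
open import Data.Bool.Properties using (T?)

-- Permutations are words (lists of naturals).  The one-line notation
-- π = π₁ ⋯ πₙ of a permutation of [n] = {1,…,n} is the list [π₁, …, πₙ].

F : ℕ → ℕ
F zero = 1
F (suc zero) = 1
F (suc (suc n)) = F (suc n) + F n

words : ℕ → ℕ → List (List ℕ)
words n zero = [] ∷ []
words n (suc k) = concatMap (λ w → map (λ a → a ∷ w) (applyUpTo suc n)) (words n k)

elem : ℕ → List ℕ → Bool
elem x [] = false
elem x (y ∷ ys) = (x ≡ᵇ y) ∨ elem x ys

distinct : List ℕ → Bool
distinct [] = true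
distinct (x ∷ xs) = not (elem x xs) ∧ distinct xs

isPerm : ℕ → List ℕ → Bool
isPerm n w = (length w ≡ᵇ n) ∧ all (λ a → (0 <ᵇ a) ∧ (a <ᵇ suc n)) w ∧ distinct w

perms : ℕ → List (List ℕ)
perms n = filter (λ w → T? (isPerm n w)) (words n n)

subseqs : ℕ → List ℕ → List (List ℕ)
subseqs zero xs = [] ∷ []
subseqs (suc k) [] = []
subseqs (suc k) (x ∷ xs) = map (x ∷_) (subseqs k xs) Data.List.++ subseqs (suc k) xs

_⇔ᵇ_ : Bool → Bool → Bool
true ⇔ᵇ c = c
false ⇔ᵇ c = not c

orderIso : List ℕ → List ℕ → Bool
orderIso [] [] = true
orderIso (u ∷ us) (v ∷ vs) = cmpAll u us v vs ∧ orderIso us vs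
  where
  cmpAll : ℕ → List ℕ → ℕ → List ℕ → Bool
  cmpAll u [] v [] = true
  cmpAll u (u' ∷ us) v (v' ∷ vs) =
    ((u <ᵇ u') ⇔ᵇ (v <ᵇ v')) ∧ ((u' <ᵇ u) ⇔ᵇ (v' <ᵇ v)) ∧ cmpAll u us v vs
  cmpAll _ _ _ _ = false
orderIso _ _ = false

contains : List ℕ → List ℕ → Bool
contains π p = any (λ s → orderIso s p) (subseqs (length p) π)

avoids : List ℕ → List ℕ → Bool
avoids π p = not (contains π p)

-- Fishburn: no indices i < j with π_j < π_i < π_{i+1} and π_i = π_j + 1.
-- For each adjacent pair (πᵢ, πᵢ₊₁) with πᵢ < πᵢ₊₁ we check that the value
-- πᵢ ∸ 1 (i.e. πᵢ - 1, which exists iff πᵢ ≥ 2) does not occur after position i.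
-- (Since πᵢ < πᵢ₊₁ and the value πᵢ - 1 ≠ πᵢ₊₁, "after position i" is the
--  same as "at some position j > i".)
fishburn : List ℕ → Bool
fishburn [] = true
fishburn (a ∷ []) = true
fishburn (a ∷ b ∷ rest) = not ((a <ᵇ b) ∧ (1 <ᵇ a) ∧ elem (a ∸ 1) (b ∷ rest)) ∧ fishburn (b ∷ rest)

good : List ℕ → Bool
good π = fishburn π ∧ avoids π (3 ∷ 2 ∷ 1 ∷ []) ∧ avoids π (3 ∷ 1 ∷ 2 ∷ 4 ∷ [])
         ∧ avoids π (4 ∷ 1 ∷ 2 ∷ 3 ∷ [])

count : ℕ → ℕ
count n = length (filter (λ π → T? (good π)) (perms n))

-- A good permutation of length n + 2 (Fishburn, avoiding 321, 3124 and 4123) is of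
-- exactly one of the forms 1 ⊕ σ with σ good of length n + 1, 21 ⊕ σ with σ good of
-- length n, or, when n ≥ 1, the single permutation 3 1 4 5 ⋯ (n+2) 2.  If π starts
-- with 2, the Fishburn condition forces π₂ = 1.  If π₁ ≥ 3, avoiding 321 puts 1 before
-- 2, and if moreover π₁ ≥ 4 also 2 before 3, giving a 4123.  If π₁ = 3, then π₂ = 1
-- (π₂ = 2 contradicts the above, π₂ ≥ 4 violates the Fishburn condition), nothing can
-- follow 2 (it would form a 3124), and avoiding 321 makes the entries between 1 and 2
-- increasing.  Hence cₙ₊₂ = cₙ₊₁ + cₙ + 1 for n ≥ 1, which with c₁ = 1 and c₂ = 2 gives
-- cₙ + 1 = Fₙ₊₁.  The list of good permutations built by this recursion is
-- duplicate-free and has the same members as the filtered list counted by `count`, so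
-- the two have the same length.

module Submission where

open import Defs
open import Data.Nat
open import Data.Nat.Properties
open import Data.Bool using (Bool; true; false; _∧_; _∨_; not; T)
open import Data.Bool.Properties using (T?; T-∧; T-∨; T-≡; T-not-≡)
open import Data.Bool.ListAction using (all)
open import Data.Unit using (tt)
open import Data.Empty using (⊥-elim)
open import Data.Product using (∃; _×_; _,_; proj₁; proj₂)
open import Data.Sum using (_⊎_; inj₁; inj₂; [_,_]′)
open import Data.List using (List; []; _∷_; map; length; filter; applyUpTo; _++_; head)
open import Data.Maybe using (just)
open import Data.Maybe.Properties using (just-injective)
open import Data.List.Properties using (length-map; length-++; map-injective; ∷-injectiveˡ; ∷-injectiveʳ)
open import Data.List.Membership.Propositional using (_∈_; _∉_; find; lose)
open import Data.List.Membership.Propositional.Properties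
open import Data.List.Relation.Unary.Any using (here; there)
open import Data.List.Relation.Unary.All using (All; []; _∷_)
open import Data.List.Relation.Unary.All.Properties using (¬Any⇒All¬; All¬⇒¬Any; all⁺; all⁻)
  renaming (map⁺ to All-map⁺; ++⁺ to All-++⁺)
import Data.List.Relation.Unary.All as All
open import Data.List.Relation.Unary.Any.Properties using (any⁺; any⁻)
open import Data.List.Relation.Unary.Unique.Propositional using (Unique)
import Data.List.Relation.Unary.Unique.Propositional.Properties as Unique
open import Data.List.Relation.Unary.AllPairs using (AllPairs; []; _∷_)
import Data.List.Relation.Unary.AllPairs as AllPairs
import Data.List.Relation.Unary.AllPairs.Properties as AllPairs
open import Data.List.Relation.Binary.Disjoint.Propositional using (Disjoint)
open import Data.List.Relation.Binary.Sublist.Propositional using (_⊆_; []; _∷_; _∷ʳ_; minimum; from∈)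
  renaming (lookup to ⊆-lookup)
open import Data.List.Relation.Binary.Sublist.Propositional.Properties
  using (All-resp-⊆; length-mono-≤; ++⁺; ++⁺ˡ; ++⁺ʳ) renaming (map⁺ to ⊆-map⁺)
open import Function.Base using (_∘_)
open import Function.Bundles using (_⇔_; mk⇔; Equivalence)
open import Relation.Binary.PropositionalEquality
open import Relation.Nullary using (¬_; Dec; yes; no; contradiction)
open import Data.List.Membership.DecPropositional _≟_ using (_∈?_)

open Equivalence using (to; from)

T-not : ∀ {b} → T (not b) ⇔ (¬ T b)
T-not {false} = mk⇔ (λ _ ()) (λ _ → tt)
T-not {true}  = mk⇔ (λ ()) (λ f → f tt)

<⇒<ᵇ≡true : ∀ {a b} → a < b → (a <ᵇ b) ≡ true
<⇒<ᵇ≡true = to T-≡ ∘ <⇒<ᵇ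

≤⇒<ᵇ≡false : ∀ {a b} → b ≤ a → (a <ᵇ b) ≡ false
≤⇒<ᵇ≡false {a} {b} b≤a = to T-not-≡ (from T-not (≤⇒≯ b≤a ∘ <ᵇ⇒< a b))

∈-remove : ∀ {A : Set} {z x : A} xs ys → z ∈ xs ++ x ∷ ys → z ≢ x → z ∈ xs ++ ys
∈-remove xs ys z∈ z≢x with ∈-++⁻ xs z∈
... | inj₁ z∈xs = ∈-++⁺ˡ z∈xs
... | inj₂ (here z≡x) = contradiction z≡x z≢x
... | inj₂ (there z∈ys) = ∈-++⁺ʳ xs z∈ys

Unique∧⊆⇒length≤ : ∀ {A : Set} {xs ys : List A} → Unique xs → (∀ {z} → z ∈ xs → z ∈ ys) →
                   length xs ≤ length ys
Unique∧⊆⇒length≤ {xs = []} _ _ = z≤n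
Unique∧⊆⇒length≤ {xs = x ∷ xs} (x∉xs ∷ u) xs⊆ys with ∈-∃++ (xs⊆ys (here refl))
... | as , bs , refl = subst (suc (length xs) ≤_) (sym length-as++x∷bs)
  (s≤s (Unique∧⊆⇒length≤ u λ z∈xs → ∈-remove as bs (xs⊆ys (there z∈xs))
                             (λ z≡x → All¬⇒¬Any x∉xs (subst (_∈ xs) z≡x z∈xs))))
  where
  length-as++x∷bs : length (as ++ x ∷ bs) ≡ suc (length (as ++ bs))
  length-as++x∷bs =
    trans (length-++ as) (trans (+-suc (length as) (length bs)) (cong suc (sym (length-++ as))))

⊆-either : ∀ {A : Set} {a b : A} {r} → a ∈ r → b ∈ r → a ≢ b → a ∷ b ∷ [] ⊆ r ⊎ b ∷ a ∷ [] ⊆ r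
⊆-either (here refl) (here refl) a≢b = contradiction refl a≢b
⊆-either (here refl) (there b∈r) _ = inj₁ (refl ∷ from∈ b∈r)
⊆-either (there a∈r) (here refl) _ = inj₂ (refl ∷ from∈ a∈r)
⊆-either {r = x ∷ _} (there a∈r) (there b∈r) a≢b =
  [ inj₁ ∘ (x ∷ʳ_) , inj₂ ∘ (x ∷ʳ_) ]′ (⊆-either a∈r b∈r a≢b)

Unique∧⊆⇒≢ : ∀ {A : Set} {a b : A} {w} → Unique w → a ∷ b ∷ [] ⊆ w → a ≢ b
Unique∧⊆⇒≢ (a∉w ∷ _) (refl ∷ τ) refl = All¬⇒¬Any a∉w (⊆-lookup τ (here refl))
Unique∧⊆⇒≢ (_ ∷ u) (_ ∷ʳ τ) = Unique∧⊆⇒≢ u τ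

⊆-chain : ∀ {A : Set} {a b c : A} {w} → Unique w → a ∷ b ∷ [] ⊆ w → b ∷ c ∷ [] ⊆ w → a ∷ b ∷ c ∷ [] ⊆ w
⊆-chain (_ ∷ u) (x ∷ʳ τ) (_ ∷ʳ σ) = x ∷ʳ ⊆-chain u τ σ
⊆-chain (x∉w ∷ _) (_ ∷ʳ τ) (refl ∷ _) = ⊥-elim (All¬⇒¬Any x∉w (⊆-lookup τ (there (here refl))))
⊆-chain _ (refl ∷ _) (_ ∷ʳ σ) = refl ∷ σ
⊆-chain (x∉w ∷ _) (refl ∷ τ) (refl ∷ _) = ⊥-elim (All¬⇒¬Any x∉w (⊆-lookup τ (here refl)))

⊆-pairs⇒AllPairs : ∀ {A : Set} {R : A → A → Set} {xs} → (∀ {y z} → y ∷ z ∷ [] ⊆ xs → R y z) → AllPairs R xs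
⊆-pairs⇒AllPairs {xs = []} _ = []
⊆-pairs⇒AllPairs {xs = x ∷ xs} pairs =
  All.tabulate (λ y∈xs → pairs (refl ∷ from∈ y∈xs)) ∷ ⊆-pairs⇒AllPairs (pairs ∘ (x ∷ʳ_))

Disjoint-head : ∀ {A : Set} {h : A} {xs ys : List (List A)} →
                All (λ w → head w ≡ just h) xs → All (λ w → head w ≢ just h) ys → Disjoint xs ys
Disjoint-head hxs ¬hys (v∈xs , v∈ys) = All.lookup ¬hys v∈ys (All.lookup hxs v∈xs)

ascending : ℕ → ℕ → List ℕ
ascending k zero = []
ascending k (suc m) = k ∷ ascending (suc k) m

Window : ℕ → ℕ → ℕ → Set
Window k m x = k ≤ x × x < k + m

ascending-window : ∀ k m → All (Window k m) (ascending k m)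
ascending-window k zero = []
ascending-window k (suc m) =
  (≤-refl , subst (k <_) (sym (+-suc k m)) (s≤s (m≤m+n k m)))
  ∷ All.map (λ {x} (k<x , x<) → <⇒≤ k<x , subst (x <_) (sym (+-suc k m)) x<) (ascending-window (suc k) m)

∈-ascending⁺ : ∀ k m {x} → Window k m x → x ∈ ascending k m
∈-ascending⁺ k zero {x} (k≤x , x<k+0) =
  ⊥-elim (<-irrefl refl (≤-trans (subst (x <_) (+-identityʳ k) x<k+0) k≤x))
∈-ascending⁺ k (suc m) {x} (k≤x , x<) with k ≟ x
... | yes refl = here refl
... | no k≢x = there (∈-ascending⁺ (suc k) m (≤∧≢⇒< k≤x k≢x , subst (x <_) (+-suc k m) x<))

ascending-increasing : ∀ k m → AllPairs _<_ (ascending k m)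
ascending-increasing k zero = []
ascending-increasing k (suc m) =
  All.map proj₁ (ascending-window (suc k) m) ∷ ascending-increasing (suc k) m

length-ascending : ∀ k m → length (ascending k m) ≡ m
length-ascending k zero = refl
length-ascending k (suc m) = cong suc (length-ascending (suc k) m)

increasing-window⇒ascending : ∀ k m {as} → AllPairs _<_ as → All (Window k m) as → length as ≡ m →
                              as ≡ ascending k m
increasing-window⇒ascending k zero {[]} _ _ _ = refl
increasing-window⇒ascending k (suc m) {h ∷ as} (h<as ∷ inc) ((k≤h , h<) ∷ win) len with k ≟ h
... | yes refl = cong (k ∷_) (increasing-window⇒ascending (suc k) m inc (narrow h<as) (suc-injective len))
  where
  narrow : All (k <_) as → All (Window (suc k) m) as
  narrow k<as = All.zipWith (λ {x} (k<x , (_ , x<)) → k<x , subst (x <_) (+-suc k m) x<) (k<as , win)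
... | no k≢h = contradiction 1+m≤m (<-irrefl refl)
  where
  k<h : k < h
  k<h = ≤∧≢⇒< k≤h k≢h
  in-window : ∀ {x} → x ∈ h ∷ as → x ∈ ascending (suc k) m
  in-window (here refl) = ∈-ascending⁺ (suc k) m (k<h , subst (h <_) (+-suc k m) h<)
  in-window {x} (there x∈as) = ∈-ascending⁺ (suc k) m
    (<-trans k<h (All.lookup h<as x∈as) , subst (x <_) (+-suc k m) (proj₂ (All.lookup win x∈as)))
  1+m≤m : suc m ≤ m
  1+m≤m = subst₂ _≤_ len (length-ascending (suc k) m)
    (Unique∧⊆⇒length≤ (AllPairs.map <⇒≢ (h<as ∷ inc)) in-window)

elem⇒∈ : ∀ x xs → T (elem x xs) → x ∈ xs
elem⇒∈ x (y ∷ ys) t with to (T-∨ {x ≡ᵇ y}) t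
... | inj₁ x≡y = here (≡ᵇ⇒≡ x y x≡y)
... | inj₂ x∈ys = there (elem⇒∈ x ys x∈ys)

∈⇒elem : ∀ {x xs} → x ∈ xs → T (elem x xs)
∈⇒elem {x} {y ∷ ys} (here x≡y) = from (T-∨ {x ≡ᵇ y}) (inj₁ (≡⇒≡ᵇ x y x≡y))
∈⇒elem {x} {y ∷ ys} (there x∈ys) = from (T-∨ {x ≡ᵇ y}) (inj₂ (∈⇒elem x∈ys))

distinct⇒Unique : ∀ w → T (distinct w) → Unique w
distinct⇒Unique [] _ = []
distinct⇒Unique (x ∷ xs) t with to (T-∧ {not (elem x xs)}) t
... | x∉xs , rest = ¬Any⇒All¬ xs (λ x∈xs → to T-not x∉xs (∈⇒elem x∈xs)) ∷ distinct⇒Unique xs rest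

Unique⇒distinct : ∀ {w} → Unique w → T (distinct w)
Unique⇒distinct [] = tt
Unique⇒distinct {x ∷ xs} (x∉xs ∷ u) =
  from (T-∧ {not (elem x xs)}) (from T-not (λ e → All¬⇒¬Any x∉xs (elem⇒∈ x xs e)) , Unique⇒distinct u)

InRange : ℕ → ℕ → ℕ → Set
InRange lo hi a = lo ≤ a × a ≤ hi

record IsPerm (n : ℕ) (w : List ℕ) : Set where
  constructor isPermutation
  field
    length≡ : length w ≡ n
    inRange : All (InRange 1 n) w
    unique : Unique w

module _ (n : ℕ) where
  private
    inRangeᵇ : ℕ → Bool
    inRangeᵇ a = (0 <ᵇ a) ∧ (a <ᵇ suc n)

    inRangeᵇ⇒InRange : ∀ {a} → T (inRangeᵇ a) → InRange 1 n a
    inRangeᵇ⇒InRange {a} t with to (T-∧ {0 <ᵇ a}) t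
    ... | 0<a , a<1+n = <ᵇ⇒< 0 a 0<a , s≤s⁻¹ (<ᵇ⇒< a (suc n) a<1+n)

    InRange⇒inRangeᵇ : ∀ {a} → InRange 1 n a → T (inRangeᵇ a)
    InRange⇒inRangeᵇ (1≤a , a≤n) = from T-∧ (<⇒<ᵇ 1≤a , <⇒<ᵇ (s≤s a≤n))

  isPerm⇒IsPerm : ∀ w → T (isPerm n w) → IsPerm n w
  isPerm⇒IsPerm w t with to (T-∧ {length w ≡ᵇ n}) t
  ... | len , t′ with to (T-∧ {all inRangeᵇ w}) t′
  ... | rng , dist = isPermutation (≡ᵇ⇒≡ _ _ len)
    (All.map inRangeᵇ⇒InRange (all⁺ inRangeᵇ w rng)) (distinct⇒Unique w dist)

  IsPerm⇒isPerm : ∀ w → IsPerm n w → T (isPerm n w)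
  IsPerm⇒isPerm w (isPermutation len rng u) = from (T-∧ {length w ≡ᵇ n})
    (≡⇒≡ᵇ _ _ len , from (T-∧ {all inRangeᵇ w})
      (all⁻ inRangeᵇ (All.map InRange⇒inRangeᵇ rng) , Unique⇒distinct u))

∈subseqs⇒⊆ : ∀ k w {s} → s ∈ subseqs k w → s ⊆ w
∈subseqs⇒⊆ zero w (here refl) = minimum w
∈subseqs⇒⊆ (suc k) (x ∷ w) s∈ with ∈-++⁻ (map (x ∷_) (subseqs k w)) s∈
... | inj₁ s∈kept with ∈-map⁻ (x ∷_) s∈kept
...   | t , t∈ , refl = refl ∷ ∈subseqs⇒⊆ k w t∈
∈subseqs⇒⊆ (suc k) (x ∷ w) s∈ | inj₂ s∈skipped = x ∷ʳ ∈subseqs⇒⊆ (suc k) w s∈skipped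

⊆⇒∈subseqs : ∀ {s w} → s ⊆ w → s ∈ subseqs (length s) w
⊆⇒∈subseqs [] = here refl
⊆⇒∈subseqs {[]} (y ∷ʳ τ) = here refl
⊆⇒∈subseqs {x ∷ s} (y ∷ʳ τ) = ∈-++⁺ʳ (map (y ∷_) (subseqs (length s) _)) (⊆⇒∈subseqs τ)
⊆⇒∈subseqs (refl ∷ τ) = ∈-++⁺ˡ (∈-map⁺ _ (⊆⇒∈subseqs τ))

-- `orderIso` compares through a where-bound helper, which cannot be named in
-- proofs; `orderIso′` is the same function with the helper lifted to top level.
-- The two agree on each concrete pattern by evaluation.
comparesLike : ℕ → List ℕ → ℕ → List ℕ → Bool
comparesLike u [] v [] = true
comparesLike u (u′ ∷ us) v (v′ ∷ vs) =
  ((u <ᵇ u′) ⇔ᵇ (v <ᵇ v′)) ∧ ((u′ <ᵇ u) ⇔ᵇ (v′ <ᵇ v)) ∧ comparesLike u us v vs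
comparesLike _ _ _ _ = false

orderIso′ : List ℕ → List ℕ → Bool
orderIso′ [] [] = true
orderIso′ (u ∷ us) (v ∷ vs) = comparesLike u us v vs ∧ orderIso′ us vs
orderIso′ _ _ = false

p321 p3124 p4123 : List ℕ
p321 = 3 ∷ 2 ∷ 1 ∷ []
p3124 = 3 ∷ 1 ∷ 2 ∷ 4 ∷ []
p4123 = 4 ∷ 1 ∷ 2 ∷ 3 ∷ []

orderIso≗orderIso′-321 : ∀ s → orderIso s p321 ≡ orderIso′ s p321
orderIso≗orderIso′-321 [] = refl
orderIso≗orderIso′-321 (_ ∷ []) = refl
orderIso≗orderIso′-321 (_ ∷ _ ∷ []) = refl
orderIso≗orderIso′-321 (_ ∷ _ ∷ _ ∷ []) = refl
orderIso≗orderIso′-321 (_ ∷ _ ∷ _ ∷ _ ∷ _) = refl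

orderIso≗orderIso′-3124 : ∀ s → orderIso s p3124 ≡ orderIso′ s p3124
orderIso≗orderIso′-3124 [] = refl
orderIso≗orderIso′-3124 (_ ∷ []) = refl
orderIso≗orderIso′-3124 (_ ∷ _ ∷ []) = refl
orderIso≗orderIso′-3124 (_ ∷ _ ∷ _ ∷ []) = refl
orderIso≗orderIso′-3124 (_ ∷ _ ∷ _ ∷ _ ∷ []) = refl
orderIso≗orderIso′-3124 (_ ∷ _ ∷ _ ∷ _ ∷ _ ∷ _) = refl

orderIso≗orderIso′-4123 : ∀ s → orderIso s p4123 ≡ orderIso′ s p4123
orderIso≗orderIso′-4123 [] = refl
orderIso≗orderIso′-4123 (_ ∷ []) = refl
orderIso≗orderIso′-4123 (_ ∷ _ ∷ []) = refl
orderIso≗orderIso′-4123 (_ ∷ _ ∷ _ ∷ []) = refl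
orderIso≗orderIso′-4123 (_ ∷ _ ∷ _ ∷ _ ∷ []) = refl
orderIso≗orderIso′-4123 (_ ∷ _ ∷ _ ∷ _ ∷ _ ∷ _) = refl

orderIso′-tail : ∀ u us v vs → T (orderIso′ (u ∷ us) (v ∷ vs)) → T (orderIso′ us vs)
orderIso′-tail u us v vs t = proj₂ (to (T-∧ {comparesLike u us v vs}) t)

orderIso′-length : ∀ s p → T (orderIso′ s p) → length s ≡ length p
orderIso′-length [] [] _ = refl
orderIso′-length (u ∷ us) (v ∷ vs) t =
  cong suc (orderIso′-length us vs (orderIso′-tail u us v vs t))

Contains : List ℕ → List ℕ → Set
Contains w p = ∃ λ s → s ⊆ w × T (orderIso′ s p)

module _ (p : List ℕ) (orderIso≗ : ∀ s → orderIso s p ≡ orderIso′ s p) where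
  private
    contains⇒Contains : ∀ w → T (contains w p) → Contains w p
    contains⇒Contains w t with find (any⁻ _ _ t)
    ... | s , s∈ , iso = s , ∈subseqs⇒⊆ (length p) w s∈ , subst T (orderIso≗ s) iso

    Contains⇒contains : ∀ {w} → Contains w p → T (contains w p)
    Contains⇒contains {w} (s , τ , iso) =
      any⁺ _ (lose (subst (λ k → s ∈ subseqs k w) (orderIso′-length s p iso) (⊆⇒∈subseqs τ))
                   (subst T (sym (orderIso≗ s)) iso))

  avoids⇔¬Contains : ∀ w → T (avoids w p) ⇔ (¬ Contains w p)
  avoids⇔¬Contains w = mk⇔
    (λ t c → to T-not t (Contains⇒contains c))
    (λ ¬c → from T-not (λ t → ¬c (contains⇒Contains w t)))

record Good (w : List ℕ) : Set where
  constructor isGood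
  field
    isFishburn : T (fishburn w)
    avoids321 : ¬ Contains w p321
    avoids3124 : ¬ Contains w p3124
    avoids4123 : ¬ Contains w p4123

good⇔Good : ∀ w → T (good w) ⇔ Good w
good⇔Good w = mk⇔ ⇒ ⇐
  where
  ⇒ : T (good w) → Good w
  ⇒ t with to (T-∧ {fishburn w}) t
  ... | f , t′ with to (T-∧ {avoids w p321}) t′
  ... | a , t″ with to (T-∧ {avoids w p3124}) t″
  ... | b , c = isGood f (to (avoids⇔¬Contains p321 orderIso≗orderIso′-321 w) a)
    (to (avoids⇔¬Contains p3124 orderIso≗orderIso′-3124 w) b)
    (to (avoids⇔¬Contains p4123 orderIso≗orderIso′-4123 w) c)
  ⇐ : Good w → T (good w)
  ⇐ (isGood f a b c) = from T-∧ (f , from T-∧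
    (from (avoids⇔¬Contains p321 orderIso≗orderIso′-321 w) a , from T-∧
    (from (avoids⇔¬Contains p3124 orderIso≗orderIso′-3124 w) b ,
     from (avoids⇔¬Contains p4123 orderIso≗orderIso′-4123 w) c)))

-- Order isomorphism and pattern containment

orderIso′-ascent : ∀ u u′ us v v′ vs → u < u′ →
                   T (orderIso′ (u ∷ u′ ∷ us) (v ∷ v′ ∷ vs)) → T (v <ᵇ v′)
orderIso′-ascent u u′ us v v′ vs u<u′ t
  with u <ᵇ u′ | <⇒<ᵇ u<u′ | v <ᵇ v′
... | true | _ | true = tt
... | true | _ | false = t

orderIso′-drop₂ : ∀ u u′ us v v′ vs →
                  T (orderIso′ (u ∷ u′ ∷ us) (v ∷ v′ ∷ vs)) → T (orderIso′ (u ∷ us) (v ∷ vs))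
orderIso′-drop₂ u u′ us v v′ vs t
  with to (T-∧ {comparesLike u (u′ ∷ us) v (v′ ∷ vs)}) t
... | cmp , rest with to (T-∧ {(u <ᵇ u′) ⇔ᵇ (v <ᵇ v′)}) cmp
... | _ , cmp′ =
  from T-∧ (proj₂ (to (T-∧ {(u′ <ᵇ u) ⇔ᵇ (v′ <ᵇ v)}) cmp′) , orderIso′-tail u′ us v′ vs rest)

orderIso′-321 : ∀ {x y z} → z < y → y < x → T (orderIso′ (x ∷ y ∷ z ∷ []) p321)
orderIso′-321 {x} {y} {z} z<y y<x
  rewrite <⇒<ᵇ≡true z<y | <⇒<ᵇ≡true y<x | <⇒<ᵇ≡true (<-trans z<y y<x)
        | ≤⇒<ᵇ≡false (<⇒≤ z<y) | ≤⇒<ᵇ≡false (<⇒≤ y<x) | ≤⇒<ᵇ≡false (<⇒≤ (<-trans z<y y<x)) = tt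

comparesLike-shift : ∀ u us v vs → comparesLike (suc u) (map suc us) v vs ≡ comparesLike u us v vs
comparesLike-shift u [] v [] = refl
comparesLike-shift u [] v (_ ∷ _) = refl
comparesLike-shift u (_ ∷ _) v [] = refl
comparesLike-shift u (u′ ∷ us) v (v′ ∷ vs) =
  cong (((u <ᵇ u′) ⇔ᵇ (v <ᵇ v′)) ∧_) (cong (((u′ <ᵇ u) ⇔ᵇ (v′ <ᵇ v)) ∧_) (comparesLike-shift u us v vs))

orderIso′-shift : ∀ s p → orderIso′ (map suc s) p ≡ orderIso′ s p
orderIso′-shift [] [] = refl
orderIso′-shift [] (_ ∷ _) = refl
orderIso′-shift (_ ∷ _) [] = refl
orderIso′-shift (u ∷ us) (v ∷ vs) = cong₂ _∧_ (comparesLike-shift u us v vs) (orderIso′-shift us vs)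

¬orderIso′-shorter : ∀ s p → length s < length p → ¬ T (orderIso′ s p)
¬orderIso′-shorter s p s<p iso = <-irrefl (orderIso′-length s p iso) s<p

¬orderIso′-minimum∷ : ∀ {a} s p q ps → All (a <_) s → ¬ T (p <ᵇ q) →
                      ¬ T (orderIso′ (a ∷ s) (p ∷ q ∷ ps))
¬orderIso′-minimum∷ [] p q ps _ _ ()
¬orderIso′-minimum∷ {a} (b ∷ s) p q ps (a<b ∷ _) p≮q iso = p≮q (orderIso′-ascent a b s p q ps a<b iso)

⊆-shift⁻ : ∀ {s} w → s ⊆ map suc w → ∃ λ t → s ≡ map suc t × t ⊆ w
⊆-shift⁻ [] [] = [] , refl , []
⊆-shift⁻ (x ∷ w) (_ ∷ʳ τ) with ⊆-shift⁻ w τ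
... | t , refl , τ′ = t , refl , x ∷ʳ τ′
⊆-shift⁻ (x ∷ w) (refl ∷ τ) with ⊆-shift⁻ w τ
... | t , refl , τ′ = x ∷ t , refl , refl ∷ τ′

Contains-shift : ∀ w p → Contains (map suc w) p ⇔ Contains w p
Contains-shift w p = mk⇔ shift⁻ shift⁺
  where
  shift⁻ : Contains (map suc w) p → Contains w p
  shift⁻ (s , τ , iso) with ⊆-shift⁻ w τ
  ... | t , refl , τ′ = t , τ′ , subst T (orderIso′-shift t p) iso
  shift⁺ : Contains w p → Contains (map suc w) p
  shift⁺ (t , τ , iso) = map suc t , ⊆-map⁺ suc τ , subst T (sym (orderIso′-shift t p)) iso

Contains-∷ : ∀ {x w p} → Contains w p → Contains (x ∷ w) p
Contains-∷ {x} (s , τ , iso) = s , x ∷ʳ τ , iso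

¬Contains-shorter : ∀ {w p} → length w < length p → ¬ Contains w p
¬Contains-shorter {p = p} w<p (s , τ , iso) = ¬orderIso′-shorter s p (≤-<-trans (length-mono-≤ τ) w<p) iso

Contains-minimum∷⁻ : ∀ {a w p q ps} → All (a <_) w → ¬ T (p <ᵇ q) →
                     Contains (a ∷ w) (p ∷ q ∷ ps) → Contains w (p ∷ q ∷ ps)
Contains-minimum∷⁻ a<w p≮q (s , _ ∷ʳ τ , iso) = s , τ , iso
Contains-minimum∷⁻ {p = p} {q} {ps} a<w p≮q (_ ∷ s , refl ∷ τ , iso) =
  ⊥-elim (¬orderIso′-minimum∷ s p q ps (All-resp-⊆ τ a<w) p≮q iso)

Contains-descent∷⁻ : ∀ {a b w p q r ps} → b < a → All (a <_) w → ¬ T (p <ᵇ q) → ¬ T (p <ᵇ r) →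
                     Contains (a ∷ b ∷ w) (p ∷ q ∷ r ∷ ps) → Contains w (p ∷ q ∷ r ∷ ps)
Contains-descent∷⁻ b<a a<w p≮q p≮r (s , _ ∷ʳ τ , iso) =
  Contains-minimum∷⁻ (All.map (<-trans b<a) a<w) p≮q (s , τ , iso)
Contains-descent∷⁻ {p = p} {q} {r} {ps} b<a a<w p≮q p≮r (_ ∷ s , refl ∷ (_ ∷ʳ τ) , iso) =
  ⊥-elim (¬orderIso′-minimum∷ s p q (r ∷ ps) (All-resp-⊆ τ a<w) p≮q iso)
Contains-descent∷⁻ {a} {b} {p = p} {q} {r} {ps} b<a a<w p≮q p≮r (_ ∷ _ ∷ s , refl ∷ refl ∷ τ , iso) =
  ⊥-elim (¬orderIso′-minimum∷ s p r ps (All-resp-⊆ τ a<w) p≮r (orderIso′-drop₂ a b s p q (r ∷ ps) iso))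

-- The Fishburn condition

violation : ℕ → ℕ → List ℕ → Bool
violation a b r = (a <ᵇ b) ∧ (1 <ᵇ a) ∧ elem (a ∸ 1) (b ∷ r)

fishburn-tail : ∀ x w → T (fishburn (x ∷ w)) → T (fishburn w)
fishburn-tail x [] _ = tt
fishburn-tail x (b ∷ r) t = proj₂ (to (T-∧ {not (violation x b r)}) t)

fishburn⇒¬violation : ∀ a b r → T (fishburn (a ∷ b ∷ r)) → ¬ T (violation a b r)
fishburn⇒¬violation a b r t = to T-not (proj₁ (to (T-∧ {not (violation a b r)}) t))

¬violation⇒fishburn : ∀ a b r → ¬ T (violation a b r) → T (fishburn (b ∷ r)) → T (fishburn (a ∷ b ∷ r))
¬violation⇒fishburn a b r ¬v f = from T-∧ (from T-not ¬v , f)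

violation⇒∈ : ∀ a b r → T (violation a b r) → a ∸ 1 ∈ b ∷ r
violation⇒∈ a b r v =
  elem⇒∈ (a ∸ 1) (b ∷ r) (proj₂ (to (T-∧ {1 <ᵇ a}) (proj₂ (to (T-∧ {a <ᵇ b}) v))))

fishburn-descent∷ : ∀ {a b} r → b ≤ a → T (fishburn (b ∷ r)) → T (fishburn (a ∷ b ∷ r))
fishburn-descent∷ {a} {b} r b≤a =
  ¬violation⇒fishburn a b r (λ v → ≤⇒≯ b≤a (<ᵇ⇒< a b (proj₁ (to (T-∧ {a <ᵇ b}) v))))

fishburn-1∷ : ∀ w → T (fishburn w) → T (fishburn (1 ∷ w))
fishburn-1∷ [] _ = tt
fishburn-1∷ (b ∷ r) = ¬violation⇒fishburn 1 b r (λ v → proj₂ (to (T-∧ {1 <ᵇ b}) v))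

elem-shift : ∀ x r → elem (suc x) (map suc r) ≡ elem x r
elem-shift x [] = refl
elem-shift x (y ∷ r) = cong ((x ≡ᵇ y) ∨_) (elem-shift x r)

¬elem-1-shift : ∀ r → All (1 ≤_) r → ¬ T (elem 1 (map suc r))
¬elem-1-shift (suc y ∷ r) (_ ∷ 1≤r) = ¬elem-1-shift r 1≤r

violation-shift⁺ : ∀ a b r → T (violation a b r) → T (violation (suc a) (suc b) (map suc r))
violation-shift⁺ zero b r v = ⊥-elim (proj₂ (to (T-∧ {0 <ᵇ b}) v))
violation-shift⁺ (suc zero) b r v = ⊥-elim (proj₂ (to (T-∧ {1 <ᵇ b}) v))
violation-shift⁺ (suc (suc a)) b r v rewrite elem-shift (suc a) r = v

violation-shift⁻ : ∀ a b r → All (1 ≤_) (a ∷ b ∷ r) →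
                   T (violation (suc a) (suc b) (map suc r)) → T (violation a b r)
violation-shift⁻ (suc zero) b r (_ ∷ 1≤br) v =
  ⊥-elim (¬elem-1-shift (b ∷ r) 1≤br (proj₂ (to (T-∧ {2 <ᵇ suc b}) v)))
violation-shift⁻ (suc (suc a)) b r _ v rewrite elem-shift (suc a) r = v

fishburn-shift⁻ : ∀ w → T (fishburn (map suc w)) → T (fishburn w)
fishburn-shift⁻ [] _ = tt
fishburn-shift⁻ (a ∷ []) _ = tt
fishburn-shift⁻ (a ∷ b ∷ r) f =
  ¬violation⇒fishburn a b r
    (fishburn⇒¬violation (suc a) (suc b) (map suc r) f ∘ violation-shift⁺ a b r)
    (fishburn-shift⁻ (b ∷ r) (fishburn-tail (suc a) (map suc (b ∷ r)) f))

fishburn-shift⁺ : ∀ w → All (1 ≤_) w → T (fishburn w) → T (fishburn (map suc w))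
fishburn-shift⁺ [] _ _ = tt
fishburn-shift⁺ (a ∷ []) _ _ = tt
fishburn-shift⁺ (a ∷ b ∷ r) 1≤abr@(_ ∷ 1≤br) f =
  ¬violation⇒fishburn (suc a) (suc b) (map suc r)
    (fishburn⇒¬violation a b r f ∘ violation-shift⁻ a b r 1≤abr)
    (fishburn-shift⁺ (b ∷ r) 1≤br (fishburn-tail a (b ∷ r) f))

-- Permutations and direct sums with 1 and 21

IsPerm⇒∈ : ∀ {n w v} → IsPerm n w → InRange 1 n v → v ∈ w
IsPerm⇒∈ {n} {w} {v} (isPermutation len rng u) (1≤v , v≤n) with v ∈? w
... | yes v∈w = v∈w
... | no v∉w = contradiction 1+n≤n (<-irrefl refl)
  where
  in-[1,n] : ∀ {x} → x ∈ v ∷ w → x ∈ ascending 1 n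
  in-[1,n] (here refl) = ∈-ascending⁺ 1 n (1≤v , s≤s v≤n)
  in-[1,n] (there x∈w) with All.lookup rng x∈w
  ... | 1≤x , x≤n = ∈-ascending⁺ 1 n (1≤x , s≤s x≤n)
  1+n≤n : suc n ≤ n
  1+n≤n = subst₂ _≤_ (cong suc len) (length-ascending 1 n)
    (Unique∧⊆⇒length≤ (¬Any⇒All¬ w v∉w ∷ u) in-[1,n])

∈-tail : ∀ {n x r v} → IsPerm n (x ∷ r) → 1 ≤ v → v < x → v ∈ r
∈-tail P@(isPermutation _ ((_ , x≤n) ∷ _) _) 1≤v v<x with IsPerm⇒∈ P (1≤v , ≤-trans (<⇒≤ v<x) x≤n)
... | here v≡x = contradiction v≡x (<⇒≢ v<x)
... | there v∈r = v∈r

1⊕_ : List ℕ → List ℕ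
1⊕ w = 1 ∷ map suc w

21⊕_ : List ℕ → List ℕ
21⊕ w = 2 ∷ 1⊕ (map suc w)

IsPerm-1⊕ : ∀ {n w} → IsPerm n w → IsPerm (suc n) (1⊕ w)
IsPerm-1⊕ {n} {w} (isPermutation len rng u) = isPermutation
  (cong suc (trans (length-map suc w) len))
  ((≤-refl , s≤s z≤n) ∷ All-map⁺ (All.map (λ (1≤a , a≤n) → m≤n⇒m≤1+n 1≤a , s≤s a≤n) rng))
  (All-map⁺ (All.map (λ (1≤a , _) 1≡1+a → <-irrefl (suc-injective 1≡1+a) 1≤a) rng)
    ∷ Unique.map⁺ suc-injective u)

IsPerm-swap : ∀ {n a b w} → IsPerm n (a ∷ b ∷ w) → IsPerm n (b ∷ a ∷ w)
IsPerm-swap (isPermutation len (ra ∷ rb ∷ rw) ((a≢b ∷ a∉w) ∷ b∉w ∷ u)) =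
  isPermutation len (rb ∷ ra ∷ rw) (((a≢b ∘ sym) ∷ b∉w) ∷ a∉w ∷ u)

IsPerm-21⊕ : ∀ {n w} → IsPerm n w → IsPerm (2 + n) (21⊕ w)
IsPerm-21⊕ = IsPerm-swap ∘ IsPerm-1⊕ ∘ IsPerm-1⊕

All-shift⁻ : ∀ {lo hi} r → All (InRange (suc lo) (suc hi)) r →
             ∃ λ w → r ≡ map suc w × All (InRange lo hi) w
All-shift⁻ [] [] = [] , refl , []
All-shift⁻ (suc a ∷ r) ((s≤s lo≤a , s≤s a≤hi) ∷ rng) with All-shift⁻ r rng
... | w , refl , rng′ = a ∷ w , refl , (lo≤a , a≤hi) ∷ rng′

IsPerm-1⊕⁻ : ∀ {n r} → IsPerm (suc n) (1 ∷ r) → ∃ λ w → r ≡ map suc w × IsPerm n w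
IsPerm-1⊕⁻ {n} {r} (isPermutation len (_ ∷ rng) (1∉r ∷ u))
  with All-shift⁻ r (All.zipWith (λ ((1≤x , x≤n) , 1≢x) → ≤∧≢⇒< 1≤x 1≢x , x≤n) (rng , 1∉r))
... | w , refl , rng′ =
  w , refl , isPermutation (trans (sym (length-map suc w)) (suc-injective len)) rng′ (Unique.map⁻ u)

IsPerm-21⊕⁻ : ∀ {n r} → IsPerm (2 + n) (2 ∷ 1 ∷ r) → ∃ λ w → r ≡ map suc (map suc w) × IsPerm n w
IsPerm-21⊕⁻ P with IsPerm-1⊕⁻ (IsPerm-swap P)
... | 1 ∷ w′ , refl , P′ with IsPerm-1⊕⁻ P′
...   | w , refl , P″ = w , refl , P″

Good-shorter-than-3 : ∀ {w} → length w < 3 → T (fishburn w) → Good w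
Good-shorter-than-3 w<3 f =
  isGood f (¬Contains-shorter w<3) (¬Contains-shorter (m<n⇒m<1+n w<3)) (¬Contains-shorter (m<n⇒m<1+n w<3))

Good-tail : ∀ {x w} → Good (x ∷ w) → Good w
Good-tail {x} {w} (isGood f a b c) =
  isGood (fishburn-tail x w f) (a ∘ Contains-∷) (b ∘ Contains-∷) (c ∘ Contains-∷)

Good-shift⁻ : ∀ {w} → Good (map suc w) → Good w
Good-shift⁻ {w} (isGood f a b c) = isGood (fishburn-shift⁻ w f)
  (a ∘ from (Contains-shift w _)) (b ∘ from (Contains-shift w _)) (c ∘ from (Contains-shift w _))

All-shift⁺ : ∀ {a w} → All (a ≤_) w → All (suc a ≤_) (map suc w)
All-shift⁺ = All-map⁺ ∘ All.map s≤s

Good-shift⁺ : ∀ {w} → All (1 ≤_) w → Good w → Good (map suc w)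
Good-shift⁺ {w} 1≤w (isGood f a b c) = isGood (fishburn-shift⁺ w 1≤w f)
  (a ∘ to (Contains-shift w _)) (b ∘ to (Contains-shift w _)) (c ∘ to (Contains-shift w _))

Good-1∷ : ∀ {w} → All (1 <_) w → Good w → Good (1 ∷ w)
Good-1∷ {w} 1<w (isGood f a b c) = isGood (fishburn-1∷ w f)
  (a ∘ Contains-minimum∷⁻ 1<w (λ ()))
  (b ∘ Contains-minimum∷⁻ 1<w (λ ()))
  (c ∘ Contains-minimum∷⁻ 1<w (λ ()))

Good-21∷ : ∀ {w} → All (2 <_) w → Good w → Good (2 ∷ 1 ∷ w)
Good-21∷ {w} 2<w (isGood f a b c) = isGood (fishburn-descent∷ {2} {1} w (s≤s z≤n) (fishburn-1∷ w f))
  (a ∘ Contains-descent∷⁻ (n<1+n 1) 2<w (λ ()) (λ ()))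
  (b ∘ Contains-descent∷⁻ (n<1+n 1) 2<w (λ ()) (λ ()))
  (c ∘ Contains-descent∷⁻ (n<1+n 1) 2<w (λ ()) (λ ()))

Good-1⊕ : ∀ {w} → All (1 ≤_) w → Good w → Good (1⊕ w)
Good-1⊕ 1≤w = Good-1∷ (All-shift⁺ 1≤w) ∘ Good-shift⁺ 1≤w

Good-21⊕ : ∀ {w} → All (1 ≤_) w → Good w → Good (21⊕ w)
Good-21⊕ {w} 1≤w = Good-21∷ (All-shift⁺ (All-shift⁺ 1≤w))
  ∘ Good-shift⁺ {map suc w} (All-map⁺ (All.map (λ _ → s≤s z≤n) 1≤w)) ∘ Good-shift⁺ 1≤w

Good-1⊕⁻ : ∀ {w} → Good (1⊕ w) → Good w
Good-1⊕⁻ {w} = Good-shift⁻ ∘ Good-tail {1} {map suc w}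

Good-21⊕⁻ : ∀ {w} → Good (21⊕ w) → Good w
Good-21⊕⁻ {w} = Good-shift⁻ ∘ Good-1⊕⁻ ∘ Good-tail {2} {1⊕ (map suc w)}

-- The exceptional permutations

exceptional : ℕ → List ℕ
exceptional m = 3 ∷ 1 ∷ ascending 4 m ++ 2 ∷ []

⊆ascending-2⇒head : ∀ k m {b c t} → b ∷ c ∷ t ⊆ ascending k m ++ 2 ∷ [] → k ≤ b
⊆ascending-2⇒head k zero (_ ∷ʳ ())
⊆ascending-2⇒head k zero (refl ∷ ())
⊆ascending-2⇒head k (suc m) (refl ∷ _) = ≤-refl
⊆ascending-2⇒head k (suc m) (_ ∷ʳ τ) = <⇒≤ (⊆ascending-2⇒head (suc k) m τ)

⊆ascending-2⇒ascent : ∀ k m {a b c t} → a ∷ b ∷ c ∷ t ⊆ ascending k m ++ 2 ∷ [] → a < b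
⊆ascending-2⇒ascent k zero (_ ∷ʳ ())
⊆ascending-2⇒ascent k zero (refl ∷ ())
⊆ascending-2⇒ascent k (suc m) (refl ∷ τ) = ⊆ascending-2⇒head (suc k) m τ
⊆ascending-2⇒ascent k (suc m) (_ ∷ʳ τ) = ⊆ascending-2⇒ascent (suc k) m τ

ascending-2>1 : ∀ m → All (1 <_) (ascending 4 m ++ 2 ∷ [])
ascending-2>1 m =
  All-++⁺ (All.map (λ (4≤x , _) → ≤-trans (s≤s (s≤s z≤n)) 4≤x) (ascending-window 4 m)) (≤-refl ∷ [])

fishburn-ascending-2 : ∀ k m → 4 ≤ k → T (fishburn (ascending k m ++ 2 ∷ []))
fishburn-ascending-2 k zero _ = tt
fishburn-ascending-2 k (suc zero) 4≤k = fishburn-descent∷ [] (≤-trans (s≤s (s≤s z≤n)) 4≤k) tt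
fishburn-ascending-2 k (suc (suc m)) 4≤k =
  ¬violation⇒fishburn k (suc k) rest (¬v ∘ violation⇒∈ k (suc k) rest)
    (fishburn-ascending-2 (suc k) (suc m) (m≤n⇒m≤1+n 4≤k))
  where
  rest : List ℕ
  rest = ascending (2 + k) m ++ 2 ∷ []
  ¬v : k ∸ 1 ∉ ascending (suc k) (suc m) ++ 2 ∷ []
  ¬v k-1∈ with ∈-++⁻ (ascending (suc k) (suc m)) k-1∈
  ... | inj₁ k-1∈asc = ≤⇒≯ (proj₁ (All.lookup (ascending-window (suc k) (suc m)) k-1∈asc)) (s≤s (m∸n≤m k 1))
  ... | inj₂ (here k-1≡2) = <-irrefl (sym k-1≡2) (∸-monoˡ-≤ 1 4≤k)

IsPerm-exceptional : ∀ m → IsPerm (3 + m) (exceptional m)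
IsPerm-exceptional m = isPermutation
  (cong (2 +_) (trans (length-++ (ascending 4 m)) (trans (cong (_+ 1) (length-ascending 4 m)) (+-comm m 1))))
  ((s≤s z≤n , s≤s (s≤s (s≤s z≤n))) ∷ (s≤s z≤n , s≤s z≤n)
    ∷ All-++⁺ (All.map (λ (4≤x , x<4+m) → ≤-trans (s≤s z≤n) 4≤x , s≤s⁻¹ x<4+m) (ascending-window 4 m))
              ((s≤s z≤n , s≤s (s≤s z≤n)) ∷ []))
  (((λ ()) ∷ All-++⁺ (All.map (λ (4≤x , _) 3≡x → <-irrefl 3≡x 4≤x) window) ((λ ()) ∷ []))
    ∷ All-++⁺ (All.map (λ (4≤x , _) 1≡x → <-irrefl 1≡x (≤-trans (s≤s (s≤s z≤n)) 4≤x)) window) ((λ ()) ∷ [])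
    ∷ Unique.++⁺ (AllPairs.map <⇒≢ (ascending-increasing 4 m)) ([] ∷ [])
        (λ { (2∈ , here refl) →
               <-irrefl refl (≤-trans (s≤s (s≤s (s≤s z≤n))) (proj₁ (All.lookup window 2∈))) }))
  where
  window : All (Window 4 m) (ascending 4 m)
  window = ascending-window 4 m

-- An occurrence not passing through both 3 and 1 begins with an ascent, because the
-- entries after 1 exceed 3 and increase up to the final 2.
exceptional-avoids : ∀ m {p q r ps} → ¬ T (p <ᵇ q) →
  (∀ {s} → s ⊆ ascending 4 m ++ 2 ∷ [] → ¬ T (orderIso′ (3 ∷ 1 ∷ s) (p ∷ q ∷ r ∷ ps))) →
  ¬ Contains (exceptional m) (p ∷ q ∷ r ∷ ps)
exceptional-avoids m {p} {q} {r} {ps} p≮q ¬through31 = avoid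
  where
  pat : List ℕ
  pat = p ∷ q ∷ r ∷ ps
  avoid : ¬ Contains (exceptional m) pat
  avoid (s@(_ ∷ _ ∷ []) , _ ∷ʳ _ ∷ʳ _ , iso) = ¬orderIso′-shorter s pat (s≤s (s≤s (s≤s z≤n))) iso
  avoid (a ∷ b ∷ c ∷ t , _ ∷ʳ _ ∷ʳ τ , iso) =
    p≮q (orderIso′-ascent a b (c ∷ t) p q (r ∷ ps) (⊆ascending-2⇒ascent 4 m τ) iso)
  avoid (_ ∷ s , _ ∷ʳ refl ∷ τ , iso) =
    ¬orderIso′-minimum∷ s p q (r ∷ ps) (All-resp-⊆ τ (ascending-2>1 m)) p≮q iso
  avoid (s@(_ ∷ _ ∷ []) , refl ∷ _ ∷ʳ _ , iso) = ¬orderIso′-shorter s pat (s≤s (s≤s (s≤s z≤n))) iso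
  avoid (_ ∷ b ∷ c ∷ t , refl ∷ _ ∷ʳ τ , iso) =
    p≮q (orderIso′-ascent 3 b (c ∷ t) p q (r ∷ ps) (⊆ascending-2⇒head 4 m τ) iso)
  avoid (_ ∷ _ ∷ _ , refl ∷ refl ∷ τ , iso) = ¬through31 τ iso

Good-exceptional : ∀ m → Good (exceptional m)
Good-exceptional m = isGood
  (fishburn-descent∷ {3} {1} run (s≤s z≤n) (fishburn-1∷ run (fishburn-ascending-2 4 m ≤-refl)))
  (exceptional-avoids m (λ ()) λ {s} τ iso →
    ¬orderIso′-minimum∷ s 2 1 [] (All-resp-⊆ τ (ascending-2>1 m)) (λ ())
      (orderIso′-tail 3 (1 ∷ s) 3 (2 ∷ 1 ∷ []) iso))
  (exceptional-avoids m (λ ()) (¬through31 3 1 2 4 (λ ())))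
  (exceptional-avoids m (λ ()) (¬through31 4 1 2 3 (λ ())))
  where
  run : List ℕ
  run = ascending 4 m ++ 2 ∷ []
  ¬through31 : ∀ p q r x {s} → ¬ T (p <ᵇ r) → s ⊆ run → ¬ T (orderIso′ (3 ∷ 1 ∷ s) (p ∷ q ∷ r ∷ x ∷ []))
  ¬through31 p q r x {[]} _ _ = ¬orderIso′-shorter (3 ∷ 1 ∷ []) (p ∷ q ∷ r ∷ x ∷ []) (s≤s (s≤s (s≤s z≤n)))
  ¬through31 p q r x {c ∷ []} _ _ =
    ¬orderIso′-shorter (3 ∷ 1 ∷ c ∷ []) (p ∷ q ∷ r ∷ x ∷ []) (s≤s (s≤s (s≤s (s≤s z≤n))))
  ¬through31 p q r x {c ∷ d ∷ t} p≮r τ iso =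
    p≮r (orderIso′-ascent 3 c (d ∷ t) p r (x ∷ []) (⊆ascending-2⇒head 4 m τ)
          (orderIso′-drop₂ 3 1 (c ∷ d ∷ t) p q (r ∷ x ∷ []) iso))

exceptionals : ℕ → List (List ℕ)
exceptionals zero = []
exceptionals (suc m) = exceptional m ∷ []

goodPerms : ℕ → List (List ℕ)
goodPerms zero = [] ∷ []
goodPerms (suc zero) = (1 ∷ []) ∷ []
goodPerms (suc (suc n)) = map 1⊕_ (goodPerms (suc n)) ++ map 21⊕_ (goodPerms n) ++ exceptionals n

goodPerms-sound : ∀ n → All (λ w → IsPerm n w × Good w) (goodPerms n)
goodPerms-sound zero = (isPermutation refl [] [] , Good-shorter-than-3 (s≤s z≤n) tt) ∷ []
goodPerms-sound (suc zero) =
  (isPermutation refl ((≤-refl , ≤-refl) ∷ []) ([] ∷ []) , Good-shorter-than-3 (s≤s (s≤s z≤n)) tt) ∷ []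
goodPerms-sound (suc (suc n)) =
  All-++⁺ (All-map⁺ (All.map extend-1⊕ (goodPerms-sound (suc n))))
    (All-++⁺ (All-map⁺ (All.map extend-21⊕ (goodPerms-sound n))) (exceptionals-sound n))
  where
  extend-1⊕ : ∀ {w} → IsPerm (suc n) w × Good w → IsPerm (2 + n) (1⊕ w) × Good (1⊕ w)
  extend-1⊕ (P , G) = IsPerm-1⊕ P , Good-1⊕ (All.map proj₁ (IsPerm.inRange P)) G
  extend-21⊕ : ∀ {w} → IsPerm n w × Good w → IsPerm (2 + n) (21⊕ w) × Good (21⊕ w)
  extend-21⊕ (P , G) = IsPerm-21⊕ P , Good-21⊕ (All.map proj₁ (IsPerm.inRange P)) G
  exceptionals-sound : ∀ n → All (λ w → IsPerm (2 + n) w × Good w) (exceptionals n)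
  exceptionals-sound zero = []
  exceptionals-sound (suc m) = (IsPerm-exceptional m , Good-exceptional m) ∷ []

length-goodPerms : ∀ n → suc (length (goodPerms (suc n))) ≡ F (suc (suc n))
length-goodPerms zero = refl
length-goodPerms (suc zero) = refl
length-goodPerms (suc (suc n)) = begin
  suc (length (map 1⊕_ A ++ map 21⊕_ B ++ exceptional n ∷ []))
    ≡⟨ cong suc (length-++ (map 1⊕_ A)) ⟩
  suc (length (map 1⊕_ A) + length (map 21⊕_ B ++ exceptional n ∷ []))
    ≡⟨ cong (λ l → suc (length (map 1⊕_ A) + l)) (length-++ (map 21⊕_ B)) ⟩
  suc (length (map 1⊕_ A) + (length (map 21⊕_ B) + 1))
    ≡⟨ cong₂ (λ a b → suc (a + (b + 1))) (length-map 1⊕_ A) (length-map 21⊕_ B) ⟩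
  suc (length A + (length B + 1))
    ≡⟨ cong (λ l → suc (length A + l)) (+-comm (length B) 1) ⟩
  suc (length A) + suc (length B)
    ≡⟨ cong₂ _+_ (length-goodPerms (suc n)) (length-goodPerms n) ⟩
  F (3 + n) + F (2 + n) ∎
  where
  open ≡-Reasoning
  A B : List (List ℕ)
  A = goodPerms (2 + n)
  B = goodPerms (1 + n)

Unique-goodPerms : ∀ n → Unique (goodPerms n)
Unique-goodPerms zero = [] ∷ []
Unique-goodPerms (suc zero) = [] ∷ []
Unique-goodPerms (suc (suc n)) =
  Unique.++⁺ (Unique.map⁺ 1⊕-injective (Unique-goodPerms (suc n)))
    (Unique.++⁺ (Unique.map⁺ 21⊕-injective (Unique-goodPerms n)) (Unique-exceptionals n)
      (Disjoint-head (heads 2 21⊕_ refl) (exceptionals-heads≢ n λ ())))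
    (Disjoint-head (heads 1 1⊕_ refl)
      (All-++⁺ (All-map⁺ (All.universal (λ _ ()) _)) (exceptionals-heads≢ n λ ())))
  where
  1⊕-injective : ∀ {v v′} → 1⊕ v ≡ 1⊕ v′ → v ≡ v′
  1⊕-injective = map-injective suc-injective ∘ ∷-injectiveʳ
  21⊕-injective : ∀ {v v′} → 21⊕ v ≡ 21⊕ v′ → v ≡ v′
  21⊕-injective = map-injective suc-injective ∘ 1⊕-injective ∘ ∷-injectiveʳ
  heads : ∀ h (f : List ℕ → List ℕ) {ws} → (∀ {w} → head (f w) ≡ just h) →
          All (λ w → head w ≡ just h) (map f ws)
  heads h f hf = All-map⁺ (All.universal (λ _ → hf) _)
  Unique-exceptionals : ∀ n → Unique (exceptionals n)
  Unique-exceptionals zero = []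
  Unique-exceptionals (suc _) = [] ∷ []
  exceptionals-heads≢ : ∀ m {h} → h ≢ 3 → All (λ w → head w ≢ just h) (exceptionals m)
  exceptionals-heads≢ zero _ = []
  exceptionals-heads≢ (suc _) h≢3 = (h≢3 ∘ sym ∘ just-injective) ∷ []

-- Completeness

1-before-2 : ∀ {n j r} → IsPerm n (3 + j ∷ r) → Good (3 + j ∷ r) → 1 ∷ 2 ∷ [] ⊆ r
1-before-2 P G with ⊆-either (∈-tail P ≤-refl (s<s z<s)) (∈-tail P (s≤s z≤n) (s<s (s<s z<s))) (λ ())
... | inj₁ 12⊆r = 12⊆r
... | inj₂ 21⊆r = ⊥-elim (Good.avoids321 G (_ , refl ∷ 21⊆r , tt))

head≥4⇒¬Good : ∀ {n j r} → IsPerm n (4 + j ∷ r) → ¬ Good (4 + j ∷ r)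
head≥4⇒¬Good P@(isPermutation _ _ (_ ∷ u)) G
  with ⊆-either (∈-tail P (s≤s z≤n) (s<s (s<s z<s))) (∈-tail P (s≤s z≤n) (s<s (s<s (s<s z<s)))) (λ ())
... | inj₂ 32⊆r = Good.avoids321 G (_ , refl ∷ 32⊆r , tt)
... | inj₁ 23⊆r = Good.avoids4123 G (_ , refl ∷ ⊆-chain u (1-before-2 P G) 23⊆r , tt)

≥1∧∉123⇒4+ : ∀ {y} → 1 ≤ y → y ≢ 1 → y ≢ 2 → y ≢ 3 → ∃ λ k → y ≡ 4 + k
≥1∧∉123⇒4+ {suc zero} _ y≢1 _ _ = contradiction refl y≢1
≥1∧∉123⇒4+ {suc (suc zero)} _ _ y≢2 _ = contradiction refl y≢2
≥1∧∉123⇒4+ {suc (suc (suc zero))} _ _ _ y≢3 = contradiction refl y≢3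
≥1∧∉123⇒4+ {suc (suc (suc (suc k)))} _ _ _ _ = k , refl

entry-after-31 : ∀ {n r x} → IsPerm n (3 ∷ 1 ∷ r) → x ∈ r → x ≢ 2 → ∃ λ k → x ≡ 4 + k
entry-after-31 (isPermutation _ rng u) x∈r x≢2 = ≥1∧∉123⇒4+
  (proj₁ (All.lookup rng (there (there x∈r))))
  (≢-sym (Unique∧⊆⇒≢ u (3 ∷ʳ refl ∷ from∈ x∈r))) x≢2 (≢-sym (Unique∧⊆⇒≢ u (refl ∷ 1 ∷ʳ from∈ x∈r)))

31-prefix⇒exceptional : ∀ {m r} → IsPerm (3 + m) (3 ∷ 1 ∷ r) → Good (3 ∷ 1 ∷ r) → 3 ∷ 1 ∷ r ≡ exceptional m
31-prefix⇒exceptional {m} P G with ∈-tail P (s≤s z≤n) (s<s (s<s z<s))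
... | there 2∈r with ∈-∃++ 2∈r
...   | as , y ∷ bs , refl with entry-after-31 P (∈-++⁺ʳ as (there (here refl)))
      (≢-sym (Unique∧⊆⇒≢ (IsPerm.unique P) (3 ∷ʳ 1 ∷ʳ ++⁺ˡ as (refl ∷ refl ∷ minimum bs))))
...     | k , refl = ⊥-elim (Good.avoids3124 G (_ , refl ∷ refl ∷ ++⁺ˡ as (refl ∷ refl ∷ minimum bs) , tt))
31-prefix⇒exceptional {m} P G | there 2∈r | as , [] , refl =
  cong (λ xs → 3 ∷ 1 ∷ xs ++ 2 ∷ [])
    (increasing-window⇒ascending 4 m increasing (All.tabulate window) length≡)
  where
  u : Unique (3 ∷ 1 ∷ as ++ 2 ∷ [])
  u = IsPerm.unique P
  entry≥4 : ∀ {x} → x ∈ as → ∃ λ k → x ≡ 4 + k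
  entry≥4 x∈as = entry-after-31 P (∈-++⁺ˡ x∈as) (Unique∧⊆⇒≢ u (3 ∷ʳ 1 ∷ʳ ++⁺ (from∈ x∈as) (refl ∷ [])))
  window : ∀ {x} → x ∈ as → Window 4 m x
  window x∈as with entry≥4 x∈as | All.lookup (IsPerm.inRange P) (there (there (∈-++⁺ˡ x∈as)))
  ... | k , refl | _ , x≤3+m = s≤s (s≤s (s≤s (s≤s z≤n))) , s≤s x≤3+m
  ascent : ∀ {y z} → y ∷ z ∷ [] ⊆ as → y < z
  ascent {y} {z} τ with y <? z | entry≥4 (⊆-lookup τ (there (here refl)))
  ... | yes y<z | _ = y<z
  ... | no y≮z | k , refl = ⊥-elim (Good.avoids321 G
    (_ , 3 ∷ʳ 1 ∷ʳ ++⁺ τ (refl ∷ []) , orderIso′-321 (s≤s (s≤s (s≤s z≤n)))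
       (≤∧≢⇒< (≮⇒≥ y≮z) (≢-sym (Unique∧⊆⇒≢ u (3 ∷ʳ 1 ∷ʳ ++⁺ʳ (2 ∷ []) τ))))))
  increasing : AllPairs _<_ as
  increasing = ⊆-pairs⇒AllPairs ascent
  length≡ : length as ≡ m
  length≡ = suc-injective (trans (+-comm 1 (length as))
    (trans (sym (length-++ as)) (suc-injective (suc-injective (IsPerm.length≡ P)))))

head3⇒exceptional : ∀ {m r} → IsPerm (3 + m) (3 ∷ r) → Good (3 ∷ r) → 3 ∷ r ≡ exceptional m
head3⇒exceptional {r = []} P G with 1-before-2 {j = 0} P G
... | ()
head3⇒exceptional {r = 0 ∷ _} (isPermutation _ (_ ∷ (() , _) ∷ _) _) _
head3⇒exceptional {r = 1 ∷ _} P G = 31-prefix⇒exceptional P G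
head3⇒exceptional {r = 2 ∷ r} P@(isPermutation _ _ (_ ∷ 2∉r ∷ _)) G with 1-before-2 {j = 0} P G
... | () ∷ _
... | _ ∷ʳ τ = ⊥-elim (All¬⇒¬Any 2∉r (⊆-lookup τ (there (here refl))))
head3⇒exceptional {r = 3 ∷ _} (isPermutation _ _ ((3≢3 ∷ _) ∷ _)) _ = contradiction refl 3≢3
head3⇒exceptional {r = suc (suc (suc (suc k))) ∷ r} P G =
  ⊥-elim (fishburn⇒¬violation 3 (4 + k) r (Good.isFishburn G) (∈⇒elem (∈-tail P (s≤s z≤n) (s<s (s<s z<s)))))

Complete : ℕ → Set
Complete n = ∀ {w} → IsPerm n w → Good w → w ∈ goodPerms n

1⊕-complete : ∀ {n r} → Complete n → IsPerm (suc n) (1 ∷ r) → Good (1 ∷ r) → 1 ∷ r ∈ map 1⊕_ (goodPerms n)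
1⊕-complete complete P G with IsPerm-1⊕⁻ P
... | v , refl , P′ = ∈-map⁺ 1⊕_ (complete P′ (Good-1⊕⁻ G))

21⊕-complete : ∀ {n r} → Complete n → IsPerm (2 + n) (2 ∷ 1 ∷ r) → Good (2 ∷ 1 ∷ r) →
               2 ∷ 1 ∷ r ∈ map 21⊕_ (goodPerms n)
21⊕-complete complete P G with IsPerm-21⊕⁻ P
... | v , refl , P′ = ∈-map⁺ 21⊕_ (complete P′ (Good-21⊕⁻ G))

goodPerms-complete : ∀ n → Complete n
goodPerms-complete zero {[]} _ _ = here refl
goodPerms-complete zero {_ ∷ _} (isPermutation () _ _) _
goodPerms-complete (suc zero) {[]} (isPermutation () _ _) _
goodPerms-complete (suc zero) {_ ∷ _ ∷ _} (isPermutation () _ _) _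
goodPerms-complete (suc zero) {0 ∷ []} (isPermutation _ ((() , _) ∷ _) _) _
goodPerms-complete (suc zero) {1 ∷ []} _ _ = here refl
goodPerms-complete (suc zero) {suc (suc _) ∷ []} (isPermutation _ ((_ , s≤s ()) ∷ _) _) _
goodPerms-complete (suc (suc n)) {[]} (isPermutation () _ _) _
goodPerms-complete (suc (suc n)) {0 ∷ _} (isPermutation _ ((() , _) ∷ _) _) _
goodPerms-complete (suc (suc n)) {1 ∷ r} P G = ∈-++⁺ˡ (1⊕-complete (goodPerms-complete (suc n)) P G)
goodPerms-complete (suc (suc n)) {2 ∷ []} (isPermutation () _ _) _
goodPerms-complete (suc (suc n)) {2 ∷ 0 ∷ _} (isPermutation _ (_ ∷ (() , _) ∷ _) _) _
goodPerms-complete (suc (suc n)) {2 ∷ 1 ∷ r} P G =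
  ∈-++⁺ʳ (map 1⊕_ (goodPerms (suc n))) (∈-++⁺ˡ (21⊕-complete (goodPerms-complete n) P G))
goodPerms-complete (suc (suc n)) {2 ∷ 2 ∷ _} (isPermutation _ _ ((2≢2 ∷ _) ∷ _)) _ = contradiction refl 2≢2
goodPerms-complete (suc (suc n)) {2 ∷ suc (suc (suc k)) ∷ r} P G =
  ⊥-elim (fishburn⇒¬violation 2 (3 + k) r (Good.isFishburn G) (∈⇒elem (∈-tail P ≤-refl (s<s z<s))))
goodPerms-complete (suc (suc zero)) {suc (suc (suc _)) ∷ _} (isPermutation _ ((_ , s≤s (s≤s ())) ∷ _) _) _
goodPerms-complete (suc (suc (suc m))) {3 ∷ r} P G =
  ∈-++⁺ʳ (map 1⊕_ (goodPerms (2 + m))) (∈-++⁺ʳ (map 21⊕_ (goodPerms (suc m))) (here (head3⇒exceptional P G)))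
goodPerms-complete (suc (suc (suc m))) {suc (suc (suc (suc j))) ∷ r} P G = ⊥-elim (head≥4⇒¬Good P G)

Unique-words : ∀ n k → Unique (words n k)
Unique-words n zero = [] ∷ []
Unique-words n (suc k) = Unique.concat⁺
  (All-map⁺ (All.universal (λ _ → Unique.map⁺ ∷-injectiveˡ letters-unique) (words n k)))
  (AllPairs.map⁺ (AllPairs.map disjoint-blocks (Unique-words n k)))
  where
  letters-unique : Unique (applyUpTo suc n)
  letters-unique = Unique.applyUpTo⁺₁ suc n (λ i<j _ → <⇒≢ (s≤s i<j))
  disjoint-blocks : ∀ {w w′} → w ≢ w′ →
                    Disjoint (map (_∷ w) (applyUpTo suc n)) (map (_∷ w′) (applyUpTo suc n))
  disjoint-blocks w≢w′ (v∈ , v∈′) with ∈-map⁻ _ v∈ | ∈-map⁻ _ v∈′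
  ... | _ , _ , v≡a∷w | _ , _ , v≡b∷w′ = w≢w′ (∷-injectiveʳ (trans (sym v≡a∷w) v≡b∷w′))

∈-words : ∀ n w → All (InRange 1 n) w → w ∈ words n (length w)
∈-words n [] [] = here refl
∈-words n (suc i ∷ w) ((_ , i<n) ∷ rng) =
  ∈-concatMap⁺ (λ v → map (_∷ v) (applyUpTo suc n))
    (lose (∈-words n w rng) (∈-map⁺ (_∷ w) (∈-applyUpTo⁺ suc i<n)))

count≡length-goodPerms : ∀ n → count n ≡ length (goodPerms n)
count≡length-goodPerms n = ≤-antisym
  (Unique∧⊆⇒length≤ (Unique.filter⁺ good? (Unique.filter⁺ isPerm? (Unique-words n n))) counted⇒listed)
  (Unique∧⊆⇒length≤ (Unique-goodPerms n) listed⇒counted)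
  where
  isPerm? : ∀ w → Dec (T (isPerm n w))
  isPerm? w = T? (isPerm n w)
  good? : ∀ w → Dec (T (good w))
  good? w = T? (good w)
  counted⇒listed : ∀ {w} → w ∈ filter good? (perms n) → w ∈ goodPerms n
  counted⇒listed w∈ with ∈-filter⁻ good? {xs = perms n} w∈
  ... | w∈perms , w-good with ∈-filter⁻ isPerm? {xs = words n n} w∈perms
  ... | _ , w-perm = goodPerms-complete n (isPerm⇒IsPerm n _ w-perm) (to (good⇔Good _) w-good)
  listed⇒counted : ∀ {w} → w ∈ goodPerms n → w ∈ filter good? (perms n)
  listed⇒counted {w} w∈ with All.lookup (goodPerms-sound n) w∈
  ... | P@(isPermutation len rng _) , G = ∈-filter⁺ good?
    (∈-filter⁺ isPerm? (subst (λ k → w ∈ words n k) len (∈-words n w rng)) (IsPerm⇒isPerm n w P))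
    (from (good⇔Good w) G)

theorem3p15 : (n : ℕ) → n ≥ 1 → count n ≡ F (suc n) ∸ 1
theorem3p15 (suc n) _ = begin
  count (suc n)                ≡⟨ count≡length-goodPerms (suc n) ⟩
  length (goodPerms (suc n))   ≡⟨ cong (_∸ 1) (length-goodPerms n) ⟩
  F (suc (suc n)) ∸ 1          ∎
  where open ≡-Reasoning
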